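{- For all $n\geq3$, $$\Pi_n(1/23,\,12/3)=\{\,12\cdots n,\ \ 1/2/\cdots/n,\ \ 1n/2/3/\cdots/n-1\,\},$$ and $\#\Pi_n(1/23,\,12/3)=3$.
   Context: For $n\ge 0$, $[n]=\{1,\dots,n\}$ and $\Pi_n$ is the set of set partitions of $[n]$. A partition is written $B_1/B_2/\cdots/B_k$ with blocks in canonical order $\min B_1<\cdots<\min B_k$ and elements of each block listed increasingly; e.g. $1n/2/3/\cdots/n-1=\{\{1,n\},\{2\},\{3\},\dots,\{n-1\}\}$. For $\pi\in\Pi_m$ and $\sigma\in\Pi_n$, $\sigma$ contains the pattern $\pi$ if there is $S\subseteq[n]$ with $\#S=m$ such that the restriction $\{B\cap S: B\in\sigma,\ B\cap S\neq\emptyset\}$, relabeled by the order-preserving bijection $S\to[m]$, equals $\pi$; otherwise $\sigma$ avoids $\pi$. For a set $R$ of patterns, $\Pi_n(R)$ is the set of $\sigma\in\Pi_n$ avoiding every pattern in $R$. -}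

module Defs where

open import Data.Nat using (ℕ; zero; suc; _≡ᵇ_; _∸_)
open import Data.Nat.Properties using (≡ᵇ⇒≡; ≡⇒≡ᵇ)
open import Data.Fin using (Fin; toℕ; _<_)
open import Data.Bool using (Bool; true; false; T; if_then_else_)
open import Data.Product using (Σ; _×_; _,_)
open import Relation.Nullary using (¬_)
open import Relation.Binary.PropositionalEquality using (_≡_; refl; sym; trans)

-- A set partition of [n] (elements indexed by Fin n, i.e. 0-based), given by
-- its (decidable) "same block" relation, which is an equivalence relation.
record Partition (n : ℕ) : Set where
  field
    same      : Fin n → Fin n → Bool
    same-refl  : ∀ i → T (same i i)
    same-sym   : ∀ i j → T (same i j) → T (same j i)
    same-trans : ∀ i j k → T (same i j) → T (same j k) → T (same i k)
open Partition public

_≈P_ : ∀ {n} → Partition n → Partition n → Set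
σ ≈P τ = ∀ i j → same σ i j ≡ same τ i j

fromLabel : ∀ {n} → (Fin n → ℕ) → Partition n
fromLabel f = record
  { same = λ i j → f i ≡ᵇ f j
  ; same-refl = λ i → ≡⇒≡ᵇ (f i) (f i) refl
  ; same-sym = λ i j p → ≡⇒≡ᵇ (f j) (f i) (sym (≡ᵇ⇒≡ (f i) (f j) p))
  ; same-trans = λ i j k p q →
      ≡⇒≡ᵇ (f i) (f k) (trans (≡ᵇ⇒≡ (f i) (f j) p) (≡ᵇ⇒≡ (f j) (f k) q))
  }

-- σ ∈ Π_n contains π ∈ Π_m: there is a subset S of [n] of size m, given by its
-- order-preserving enumeration e : [m] → S, such that the restriction of σ to S,
-- relabelled through e, equals π.
Contains : ∀ {n m} → Partition n → Partition m → Set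
Contains {n} {m} σ π =
  Σ (Fin m → Fin n) λ e →
    (∀ i j → i < j → e i < e j) × (∀ i j → same π i j ≡ same σ (e i) (e j))

Avoids : ∀ {n m} → Partition n → Partition m → Set
Avoids σ π = ¬ Contains σ π

pat-1/23 : Partition 3
pat-1/23 = fromLabel λ i → if toℕ i ≡ᵇ 0 then 0 else 1

pat-12/3 : Partition 3
pat-12/3 = fromLabel λ i → if toℕ i ≡ᵇ 2 then 1 else 0

oneBlock : (n : ℕ) → Partition n
oneBlock n = fromLabel λ _ → 0

singletons : (n : ℕ) → Partition n
singletons n = fromLabel toℕ

-- 1n/2/3/⋯/n-1 : element n (0-based index n-1) shares a block with element 1
-- (index 0); all other blocks are singletons.
firstLast : (n : ℕ) → Partition n
firstLast n = fromLabel λ i → if toℕ i ≡ᵇ (n ∸ 1) then 0 else toℕ i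

{-# OPTIONS --safe #-}
module Submission where

-- Avoiding 1/23 means: if i < j share a block, then every h < i shares the block of i.
-- Avoiding 12/3 means: if i < j share a block, then every k > j shares it too.
-- If 1 and 2 share a block, the second rule puts every element into it. Otherwise a
-- block containing i < j must have i = 1, since for i > 1 the first rule would put both
-- 1 and 2 into the block of i; and it must have j = n, since for j < n the second rule
-- puts n into the block of 1 and j, and the first rule then puts 2 there as well.
-- So the only possible non-singleton block is {1, n}. (Elements 1, 2, n are 0F, 1F,
-- fromℕ _ in the code.)

open import Defs
open import Data.Nat using (ℕ; suc; _≤_; _≡ᵇ_; s≤s; z<s; s<s)
import Data.Nat.Properties as ℕ
open import Data.Fin using (Fin; suc; toℕ; fromℕ; _<_)
open import Data.Fin.Patterns using (0F; 1F; 2F)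
open import Data.Fin.Properties using (toℕ-injective; toℕ-fromℕ; toℕ≤pred[n]; ≤fromℕ; ≤∧≢⇒<; <-cmp; <-trans; _≟_)
open import Data.Bool using (Bool; true; false; T)
open import Data.Bool.Properties using (T-≡)
open import Data.Unit using (tt)
open import Data.Empty using (⊥-elim)
open import Data.Product using (_×_; _,_; map)
open import Data.Sum using (_⊎_; inj₁; inj₂)
open import Function using (case_of_; Equivalence)
open Equivalence using (to; from)
open import Relation.Nullary using (¬_; yes; no)
open import Relation.Nullary.Decidable using (T?; decidable-stable)
open import Relation.Binary using (tri<; tri≈; tri>)
open import Relation.Binary.PropositionalEquality using (_≡_; refl; sym; trans; subst)

private
  variable
    m n : ℕ
    h i j k : Fin n

T-injective : ∀ {a b : Bool} → (T a → T b) → (T b → T a) → a ≡ b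
T-injective {false} {false} _ _ = refl
T-injective {false} {true}  _ g = ⊥-elim (g tt)
T-injective {true}  {false} f _ = ⊥-elim (f tt)
T-injective {true}  {true}  _ _ = refl

module _ (σ : Partition n) where

  same-diag : ∀ i → same σ i i ≡ true
  same-diag i = to T-≡ (same-refl σ i)

  same-comm : ∀ i j → same σ i j ≡ same σ j i
  same-comm i j = T-injective (same-sym σ i j) (same-sym σ j i)

≈P-from-< : (σ τ : Partition n) → (∀ {i j} → i < j → same σ i j ≡ same τ i j) → σ ≈P τ
≈P-from-< σ τ agree< i j with <-cmp i j
... | tri< i<j _ _  = agree< i<j
... | tri≈ _ refl _ = trans (same-diag σ i) (sym (same-diag τ i))
... | tri> _ _ j<i  = trans (same-comm σ i j) (trans (agree< j<i) (same-comm τ j i))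

Avoids-resp-≈P : (σ τ : Partition n) (π : Partition m) → σ ≈P τ → Avoids τ π → Avoids σ π
Avoids-resp-≈P σ τ π σ≈τ τ-avoids (e , mono , agree) =
  τ-avoids (e , mono , λ a b → trans (agree a b) (σ≈τ (e a) (e b)))

oneBlock-avoids : (π : Partition m) (a b : Fin m) → same π a b ≡ false → Avoids (oneBlock n) π
oneBlock-avoids π a b apart (_ , _ , agree) = case trans (sym apart) (agree a b) of λ ()

triple : Fin n → Fin n → Fin n → Fin 3 → Fin n
triple h i j 0F = h
triple h i j 1F = i
triple h i j 2F = j

triple-strictMono : h < i → i < j → ∀ a b → a < b → triple h i j a < triple h i j b
triple-strictMono h<i i<j 0F 1F _ = h<i
triple-strictMono h<i i<j 0F 2F _ = <-trans h<i i<j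
triple-strictMono h<i i<j 1F 2F _ = i<j
triple-strictMono _ _ _ 0F ()
triple-strictMono _ _ (suc _) 1F (s≤s ())
triple-strictMono _ _ 2F 2F (s≤s (s≤s ()))

-- By reflexivity and symmetry an occurrence of a pattern on three points is
-- determined by the three pairs above the diagonal.
triple-contains : (π : Partition 3) (σ : Partition n) → h < i → i < j →
                  same π 0F 1F ≡ same σ h i → same π 0F 2F ≡ same σ h j →
                  same π 1F 2F ≡ same σ i j → Contains σ π
triple-contains {h = h} {i = i} {j = j} π σ h<i i<j hi hj ij =
  triple h i j , triple-strictMono h<i i<j , agree
  where
    agree : ∀ a b → same π a b ≡ same σ (triple h i j a) (triple h i j b)
    agree 0F 0F = trans (same-diag π 0F) (sym (same-diag σ h))
    agree 1F 1F = trans (same-diag π 1F) (sym (same-diag σ i))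
    agree 2F 2F = trans (same-diag π 2F) (sym (same-diag σ j))
    agree 0F 1F = hi
    agree 0F 2F = hj
    agree 1F 2F = ij
    agree 1F 0F = trans (same-comm π 1F 0F) (trans hi (same-comm σ h i))
    agree 2F 0F = trans (same-comm π 2F 0F) (trans hj (same-comm σ h j))
    agree 2F 1F = trans (same-comm π 2F 1F) (trans ij (same-comm σ i j))

module _ (σ : Partition n) where

  avoids-1/23⇒same-left : Avoids σ pat-1/23 → h < i → i < j →
                          T (same σ i j) → T (same σ h i)
  avoids-1/23⇒same-left {h} {i} {j} avoids h<i i<j i~j =
    decidable-stable (T? (same σ h i)) λ h≁i →
      avoids (triple-contains pat-1/23 σ h<i i<j
        (T-injective (λ ()) h≁i)
        (T-injective (λ ()) λ h~j → h≁i (same-trans σ h j i h~j (same-sym σ i j i~j)))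
        (T-injective (λ _ → i~j) (λ _ → tt)))

  avoids-12/3⇒same-right : Avoids σ pat-12/3 → i < j → j < k →
                           T (same σ i j) → T (same σ i k)
  avoids-12/3⇒same-right {i} {j} {k} avoids i<j j<k i~j =
    decidable-stable (T? (same σ i k)) λ i≁k →
      avoids (triple-contains pat-12/3 σ i<j j<k
        (T-injective (λ _ → i~j) (λ _ → tt))
        (T-injective (λ ()) i≁k)
        (T-injective (λ ()) λ j~k → i≁k (same-trans σ i j k i~j j~k)))

LinksOnlyEnds : Partition (suc n) → Set
LinksOnlyEnds {n} σ = ∀ {i j} → i < j → T (same σ i j) → i ≡ 0F × j ≡ fromℕ n

module _ (σ : Partition (suc (suc n))) where

  avoids-1/23⇒same-01 : Avoids σ pat-1/23 → suc i < j → T (same σ (suc i) j) → T (same σ 0F 1F)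
  avoids-1/23⇒same-01 {0F}    avoids i<j i~j = avoids-1/23⇒same-left σ avoids z<s i<j i~j
  avoids-1/23⇒same-01 {suc _} avoids i<j i~j =
    same-trans σ _ _ _ (avoids-1/23⇒same-left σ avoids z<s i<j i~j)
      (same-sym σ _ _ (avoids-1/23⇒same-left σ avoids (s<s z<s) i<j i~j))

  avoids-both⇒linksOnlyEnds : Avoids σ pat-1/23 → Avoids σ pat-12/3 →
                              ¬ T (same σ 0F 1F) → LinksOnlyEnds σ
  avoids-both⇒linksOnlyEnds no-1/23 _ 0≁1 {suc _} i<j i~j =
    ⊥-elim (0≁1 (avoids-1/23⇒same-01 no-1/23 i<j i~j))
  avoids-both⇒linksOnlyEnds no-1/23 no-12/3 0≁1 {0F} {j@(suc _)} 0<j 0~j with j ≟ fromℕ _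
  ... | yes j≡last = refl , j≡last
  ... | no j≢last  = ⊥-elim (0≁1 (avoids-1/23⇒same-01 no-1/23 j<last j~last))
    where
      j<last = ≤∧≢⇒< (≤fromℕ j) j≢last
      j~last = same-trans σ _ _ _ (same-sym σ _ _ 0~j)
                 (avoids-12/3⇒same-right σ no-12/3 0<j j<last 0~j)

  same-01⇒≈P-oneBlock : Avoids σ pat-12/3 → T (same σ 0F 1F) → σ ≈P oneBlock _
  same-01⇒≈P-oneBlock avoids 0~1 i j =
    T-injective (λ _ → tt) (λ _ → same-trans σ i 0F j (same-sym σ 0F i (0~ i)) (0~ j))
    where
      0~ : ∀ k → T (same σ 0F k)
      0~ 0F            = same-refl σ 0F
      0~ 1F            = 0~1
      0~ (suc (suc _)) = avoids-12/3⇒same-right σ avoids z<s (s<s z<s) 0~1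

linksOnlyEnds-transfer : (σ τ : Partition (suc n)) → LinksOnlyEnds σ →
                         same σ 0F (fromℕ n) ≡ same τ 0F (fromℕ n) →
                         i < j → T (same σ i j) → T (same τ i j)
linksOnlyEnds-transfer σ τ σ-ends ends i<j i~j with σ-ends i<j i~j
... | refl , refl = subst T ends i~j

linksOnlyEnds-≈P : (σ τ : Partition (suc n)) → LinksOnlyEnds σ → LinksOnlyEnds τ →
                   same σ 0F (fromℕ n) ≡ same τ 0F (fromℕ n) → σ ≈P τ
linksOnlyEnds-≈P σ τ σ-ends τ-ends ends = ≈P-from-< σ τ λ i<j →
  T-injective (linksOnlyEnds-transfer σ τ σ-ends ends i<j)
              (linksOnlyEnds-transfer τ σ τ-ends (sym ends) i<j)

linksOnlyEnds⇒avoids-1/23 : (ρ : Partition (suc n)) → LinksOnlyEnds ρ → Avoids ρ pat-1/23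
linksOnlyEnds⇒avoids-1/23 ρ ends (e , mono , agree) =
  let e1≡0 , _ = ends (mono 1F 2F (s<s z<s)) (subst T (agree 1F 2F) tt)
  in  ℕ.n≮0 (subst (e 0F <_) e1≡0 (mono 0F 1F z<s))

linksOnlyEnds⇒avoids-12/3 : (ρ : Partition (suc n)) → LinksOnlyEnds ρ → Avoids ρ pat-12/3
linksOnlyEnds⇒avoids-12/3 ρ ends (e , mono , agree) =
  let _ , e1≡last = ends (mono 0F 1F z<s) (subst T (agree 0F 1F) tt)
  in  ℕ.<⇒≱ (subst (_< e 2F) e1≡last (mono 1F 2F (s<s z<s))) (≤fromℕ (e 2F))

linksOnlyEnds⇒avoids-both : (ρ : Partition (suc n)) → LinksOnlyEnds ρ →
                            Avoids ρ pat-1/23 × Avoids ρ pat-12/3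
linksOnlyEnds⇒avoids-both ρ ends = linksOnlyEnds⇒avoids-1/23 ρ ends , linksOnlyEnds⇒avoids-12/3 ρ ends

singletons-linksOnlyEnds : LinksOnlyEnds (singletons (suc n))
singletons-linksOnlyEnds i<j i~j = ⊥-elim (ℕ.<-irrefl (ℕ.≡ᵇ⇒≡ _ _ i~j) i<j)

firstLast-linksOnlyEnds : LinksOnlyEnds (firstLast (suc n))
firstLast-linksOnlyEnds {n} {i} {j} i<j i~j
  with toℕ i ≡ᵇ n in i-last | toℕ j ≡ᵇ n in j-last
... | true  | _     =
  ⊥-elim (ℕ.<-irrefl (ℕ.≡ᵇ⇒≡ _ _ (from T-≡ i-last)) (ℕ.<-≤-trans i<j (toℕ≤pred[n] j)))
... | false | true  = toℕ-injective (ℕ.≡ᵇ⇒≡ _ 0 i~j)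
                    , toℕ-injective (trans (ℕ.≡ᵇ⇒≡ _ _ (from T-≡ j-last)) (sym (toℕ-fromℕ n)))
... | false | false = ⊥-elim (ℕ.<-irrefl (ℕ.≡ᵇ⇒≡ _ _ i~j) i<j)

firstLast-ends : ∀ n → same (firstLast (suc n)) 0F (fromℕ n) ≡ true
firstLast-ends n with 0 ≡ᵇ n | toℕ (fromℕ n) ≡ᵇ n | ℕ.≡⇒≡ᵇ (toℕ (fromℕ n)) n (toℕ-fromℕ n)
... | true  | true | _ = refl
... | false | true | _ = refl

linksOnlyEnds-classified : (σ : Partition (suc (suc n))) → LinksOnlyEnds σ →
                           σ ≈P singletons _ ⊎ σ ≈P firstLast _
linksOnlyEnds-classified {n} σ σ-ends with same σ 0F (fromℕ _) in ends
... | false = inj₁ (linksOnlyEnds-≈P σ (singletons _) σ-ends singletons-linksOnlyEnds ends)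
... | true  = inj₂ (linksOnlyEnds-≈P σ (firstLast _) σ-ends firstLast-linksOnlyEnds
                                     (trans ends (sym (firstLast-ends (suc n)))))

avoids-both⇒listed : (σ : Partition (suc (suc n))) → Avoids σ pat-1/23 × Avoids σ pat-12/3 →
                     σ ≈P oneBlock _ ⊎ σ ≈P singletons _ ⊎ σ ≈P firstLast _
avoids-both⇒listed σ (no-1/23 , no-12/3) with T? (same σ 0F 1F)
... | yes 0~1 = inj₁ (same-01⇒≈P-oneBlock σ no-12/3 0~1)
... | no 0≁1  =
  inj₂ (linksOnlyEnds-classified σ (avoids-both⇒linksOnlyEnds σ no-1/23 no-12/3 0≁1))

avoids-both-resp-≈P : (σ τ : Partition n) → σ ≈P τ →
                      Avoids τ pat-1/23 × Avoids τ pat-12/3 → Avoids σ pat-1/23 × Avoids σ pat-12/3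
avoids-both-resp-≈P σ τ σ≈τ = map (Avoids-resp-≈P σ τ pat-1/23 σ≈τ) (Avoids-resp-≈P σ τ pat-12/3 σ≈τ)

listed⇒avoids-both : (σ : Partition (suc n)) →
                     σ ≈P oneBlock _ ⊎ σ ≈P singletons _ ⊎ σ ≈P firstLast _ →
                     Avoids σ pat-1/23 × Avoids σ pat-12/3
listed⇒avoids-both σ (inj₁ σ≈) = avoids-both-resp-≈P σ (oneBlock _) σ≈
  (oneBlock-avoids pat-1/23 0F 1F refl , oneBlock-avoids pat-12/3 0F 2F refl)
listed⇒avoids-both σ (inj₂ (inj₁ σ≈)) = avoids-both-resp-≈P σ (singletons _) σ≈
  (linksOnlyEnds⇒avoids-both (singletons _) singletons-linksOnlyEnds)
listed⇒avoids-both σ (inj₂ (inj₂ σ≈)) = avoids-both-resp-≈P σ (firstLast _) σ≈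
  (linksOnlyEnds⇒avoids-both (firstLast _) firstLast-linksOnlyEnds)

oneBlock≉singletons : ¬ (oneBlock (suc (suc n)) ≈P singletons _)
oneBlock≉singletons eq = case eq 0F 1F of λ ()

oneBlock≉firstLast : ¬ (oneBlock (suc (suc (suc n))) ≈P firstLast _)
oneBlock≉firstLast eq = case eq 0F 1F of λ ()

singletons≉firstLast : ¬ (singletons (suc (suc n)) ≈P firstLast _)
singletons≉firstLast {n} eq = case trans (eq 0F (fromℕ _)) (firstLast-ends (suc n)) of λ ()

proposition2p7 : (n : ℕ) → 3 ≤ n →
    ((σ : Partition n) →
      ((Avoids σ pat-1/23 × Avoids σ pat-12/3) →
        (σ ≈P oneBlock n ⊎ σ ≈P singletons n ⊎ σ ≈P firstLast n))
      × ((σ ≈P oneBlock n ⊎ σ ≈P singletons n ⊎ σ ≈P firstLast n) →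
        (Avoids σ pat-1/23 × Avoids σ pat-12/3)))
    × ¬ (oneBlock n ≈P singletons n)
    × ¬ (oneBlock n ≈P firstLast n)
    × ¬ (singletons n ≈P firstLast n)
proposition2p7 (suc (suc (suc _))) (s≤s (s≤s (s≤s _))) =
  (λ σ → avoids-both⇒listed σ , listed⇒avoids-both σ) ,
  oneBlock≉singletons , oneBlock≉firstLast , singletons≉firstLast
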